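{- Every symmetric even cycle of girth at least 4 is S\l upecki; that is, for every $m\geq 2$, the reflexive digraph on $\{0,1,\dots,2m-1\}$ whose non-loop arcs are exactly $(i,i+1)$ and $(i+1,i)$ for all $i$ (indices modulo $2m$) is S\l upecki.
   Context: All digraphs are finite and reflexive. A $k$-ary polymorphism is a homomorphism $\mathbb{G}^k\to\mathbb{G}$ from the product digraph; it is essentially unary if it equals $(x_1,\dots,x_k)\mapsto g(x_i)$ for some $i$ and homomorphism $g:\mathbb{G}\to\mathbb{G}$. $\mathbb{G}$ is S\l upecki if for every $k\geq 2$ every surjective $k$-ary polymorphism is essentially unary. -}

module Defs where

open import Data.Nat using (ℕ; suc; _+_; _*_; _%_; _≥_)
open import Data.Fin using (Fin; toℕ)
open import Data.Product using (Σ; ∃; _×_)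
open import Data.Sum using (_⊎_)
open import Data.Empty using (⊥)
open import Relation.Binary.PropositionalEquality using (_≡_)

record Digraph : Set₁ where
  field
    size : ℕ
    E    : Fin size → Fin size → Set

open Digraph public

Reflexive : Digraph → Set
Reflexive G = ∀ v → E G v v

IsHom : (G : Digraph) → (Fin (size G) → Fin (size G)) → Set
IsHom G g = ∀ u v → E G u v → E G (g u) (g v)

-- k-ary polymorphism: homomorphism G^k → G, where tuples are functions Fin k → V
-- and (x , y) is an arc of G^k iff (x i , y i) is an arc of G for every i.
IsPolymorphism : (G : Digraph) (k : ℕ) → ((Fin k → Fin (size G)) → Fin (size G)) → Set
IsPolymorphism G k f =
  ∀ (x y : Fin k → Fin (size G)) → (∀ i → E G (x i) (y i)) → E G (f x) (f y)

Surjective : (G : Digraph) (k : ℕ) → ((Fin k → Fin (size G)) → Fin (size G)) → Set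
Surjective G k f = ∀ v → ∃ λ x → f x ≡ v

EssentiallyUnary : (G : Digraph) (k : ℕ) → ((Fin k → Fin (size G)) → Fin (size G)) → Set
EssentiallyUnary G k f =
  Σ (Fin k) λ i → Σ (Fin (size G) → Fin (size G)) λ g → IsHom G g × (∀ x → f x ≡ g (x i))

Slupecki : Digraph → Set
Slupecki G =
  ∀ (k : ℕ) → k ≥ 2 → (f : (Fin k → Fin (size G)) → Fin (size G)) →
  IsPolymorphism G k f → Surjective G k f → EssentiallyUnary G k f

CycleArc : (n : ℕ) → Fin (suc n) → Fin (suc n) → Set
CycleArc n i j =
  (toℕ i ≡ toℕ j) ⊎ ((toℕ j ≡ (toℕ i + 1) % suc n) ⊎ (toℕ i ≡ (toℕ j + 1) % suc n))

-- Even symmetric cycle on {0,…,2m-1} (arc relation taken mod 2m).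
-- For m = 0 this is a degenerate placeholder (never used: the theorem assumes m ≥ 2).
EvenCycle : ℕ → Digraph
EvenCycle 0 = record { size = 0 ; E = λ _ _ → ⊥ }
EvenCycle (suc m') = record { size = suc (suc (2 * m')) ; E = CycleArc (suc (2 * m')) }

module Submission where

-- Identify the vertices of the cycle with residues modulo n = 2m. A polymorphism φ of arity k is
-- analysed by induction on k, fixing its first argument to 0. If the restriction is unary,
-- x ↦ g (x i) with g a rotation or reflection of the cycle, then so is φ: a vertex adjacent to
-- three consecutive vertices is the middle one (as n ≥ 4), and this propagates along edges.
-- Otherwise the restriction lifts to a 1-Lipschitz map into ℕ. Lifting also the closed walks
-- t ↦ φ (t ∷ x), either they wind once around the cycle and φ is unary in its first argument,
-- or none winds and the lifts glue to a 1-Lipschitz lift of φ. Such a lift is impossible for a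
-- surjective polymorphism: any two tuples are joined by a walk of length m, so the lift takes
-- values within m of each other, and these miss some residue modulo 2m.

open import Defs
open import Data.Nat using (ℕ; zero; suc; pred; _+_; _*_; _∸_; _%_; _≤_; _<_; _≥_; z≤n; s≤s; z<s; _≟_; _≤?_)
open import Data.Nat.Properties
open import Data.Nat.DivMod using (%-distribˡ-+; m%n%n≡m%n; [m+n]%n≡m%n; m%n<n; m<n⇒m%n≡m; m≤n⇒[n∸m]%m≡n%m; n%n≡0)
open import Data.Nat.GeneralisedArithmetic using (fold; iterate; iterate-is-fold)
open import Data.Fin as Fin using (Fin; toℕ; fromℕ<)
open import Data.Fin.Properties using (toℕ<n; toℕ-fromℕ<; toℕ-injective)
open import Data.Vec using (Vec; []; _∷_; lookup; tabulate; replicate; updateAt)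
open import Data.Vec.Properties using (lookup∘tabulate; lookup∘updateAt)
open import Data.Vec.Relation.Binary.Pointwise.Inductive as Pointwise using (Pointwise; []; _∷_; tabulate⁺)
open import Data.Product using (Σ; _×_; _,_; proj₁; proj₂)
open import Data.Sum as Sum using (_⊎_; inj₁; inj₂)
open import Data.Empty using (⊥; ⊥-elim)
open import Function using (id)
open import Level using (0ℓ)
open import Relation.Binary.Bundles using (Setoid)
open import Relation.Binary.Definitions using (Decidable; tri<; tri≈; tri>)
open import Relation.Binary.PropositionalEquality
open import Relation.Nullary using (yes; no)
open import Relation.Nullary.Decidable using (map′)

private variable
  X Y Z : ℕ
  S : ℕ → ℕ

Near : ℕ → ℕ → Set
Near X Y = X ≤ suc Y × Y ≤ suc X

Near-refl : ∀ X → Near X X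
Near-refl X = n≤1+n X , n≤1+n X

Near-sym : Near X Y → Near Y X
Near-sym (X≤1+Y , Y≤1+X) = Y≤1+X , X≤1+Y

Near-suc : ∀ X → Near X (suc X)
Near-suc X = m≤n⇒m≤1+n (n≤1+n X) , ≤-refl

Near-trans-≤2 : Near X Y → Near Y Z → X ≤ 2 + Z × Z ≤ 2 + X
Near-trans-≤2 (X≤1+Y , Y≤1+X) (Y≤1+Z , Z≤1+Y) = ≤-trans X≤1+Y (s≤s Y≤1+Z) , ≤-trans Z≤1+Y (s≤s Y≤1+X)

Near-+ˡ : ∀ c → Near X Y → Near (c + X) (c + Y)
Near-+ˡ {X} {Y} c (X≤1+Y , Y≤1+X) =
  ≤-trans (+-monoʳ-≤ c X≤1+Y) (≤-reflexive (+-suc c Y)) , ≤-trans (+-monoʳ-≤ c Y≤1+X) (≤-reflexive (+-suc c X))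

Steps : (ℕ → ℕ) → ℕ → Set
Steps S N = ∀ j → j < N → Near (S j) (S (suc j))

Steps-prefix : ∀ {N j} → Steps S N → j ≤ N → Steps S j
Steps-prefix steps j≤N i i<j = steps i (<-≤-trans i<j j≤N)

Steps-suffix : ∀ {N} j d → Steps S N → d + j ≤ N → Steps (λ i → S (i + j)) d
Steps-suffix j d steps d+j≤N i i<d = steps (i + j) (≤-trans (+-monoˡ-< j i<d) d+j≤N)

drift : ∀ N → Steps S N → S N ≤ N + S 0 × S 0 ≤ N + S N
drift zero _ = ≤-refl , ≤-refl
drift {S} (suc N) steps with drift N (Steps-prefix steps (n≤1+n N)) | steps N ≤-refl
... | SN≤ , S0≤ | SN≤1+ , S1+N≤ =
  ≤-trans S1+N≤ (s≤s SN≤) , ≤-trans S0≤ (≤-trans (+-monoʳ-≤ N SN≤1+) (≤-reflexive (+-suc N (S (suc N)))))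

drift-to-end : ∀ {N} j → Steps S N → j ≤ N → S N ≤ (N ∸ j) + S j × S j ≤ (N ∸ j) + S N
drift-to-end {S} {N} j steps j≤N =
  subst (λ k → S k ≤ (N ∸ j) + S j × S j ≤ (N ∸ j) + S k) (m∸n+n≡m j≤N)
        (drift (N ∸ j) (Steps-suffix j (N ∸ j) steps (≤-reflexive (m∸n+n≡m j≤N))))

climbing-linear : ∀ {N} → Steps S N → S N ≡ N + S 0 → ∀ j → j ≤ N → S j ≡ j + S 0
climbing-linear {S} {N} steps SN≡ j j≤N =
  ≤-antisym (proj₁ (drift j (Steps-prefix steps j≤N))) (+-cancelˡ-≤ (N ∸ j) _ _ (begin
    N ∸ j + (j + S 0)  ≡⟨ +-assoc (N ∸ j) j (S 0) ⟨
    N ∸ j + j + S 0    ≡⟨ cong (_+ S 0) (m∸n+n≡m j≤N) ⟩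
    N + S 0            ≡⟨ SN≡ ⟨
    S N                ≤⟨ proj₁ (drift-to-end j steps j≤N) ⟩
    N ∸ j + S j        ∎))
  where open ≤-Reasoning

descending-linear : ∀ {N} → Steps S N → S 0 ≡ N + S N → ∀ j → j ≤ N → j + S j ≡ S 0
descending-linear {S} {N} steps S0≡ j j≤N =
  ≤-antisym (begin
    j + S j                ≤⟨ +-monoʳ-≤ j (proj₂ (drift-to-end j steps j≤N)) ⟩
    j + (N ∸ j + S N)      ≡⟨ +-assoc j (N ∸ j) (S N) ⟨
    j + (N ∸ j) + S N      ≡⟨ cong (_+ S N) (m+[n∸m]≡n j≤N) ⟩
    N + S N                ≡⟨ S0≡ ⟨
    S 0                    ∎) (proj₂ (drift j (Steps-prefix steps j≤N)))
  where open ≤-Reasoning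

climbing : ∀ {N} → Steps S N → S N ≡ N + S 0 → ∀ j → j < N → S (suc j) ≡ suc (S j)
climbing steps SN≡ j j<N =
  trans (climbing-linear steps SN≡ (suc j) j<N) (cong suc (sym (climbing-linear steps SN≡ j (<⇒≤ j<N))))

descending : ∀ {N} → Steps S N → S 0 ≡ N + S N → ∀ j → j < N → suc (S (suc j)) ≡ S j
descending {S} steps S0≡ j j<N = +-cancelˡ-≡ j _ _ (begin
    j + suc (S (suc j))  ≡⟨ +-suc j _ ⟩
    suc j + S (suc j)    ≡⟨ descending-linear steps S0≡ (suc j) j<N ⟩
    S 0                  ≡⟨ descending-linear steps S0≡ j (<⇒≤ j<N) ⟨
    j + S j              ∎)
  where open ≡-Reasoning

positive : ∀ {N j X Y} → j < N → N + Y ≤ j + X → 0 < X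
positive {N} {j} {zero} {Y} j<N N+Y≤j+0 =
  ⊥-elim (<⇒≱ j<N (≤-trans (m≤m+n N Y) (subst (N + Y ≤_) (+-identityʳ j) N+Y≤j+0)))
positive {X = suc _} _ _ = z<s

toward : ℕ → ℕ → ℕ
toward zero    X       = pred X
toward (suc B) zero    = 1
toward (suc B) (suc X) = suc (toward B X)

Near-toward : ∀ B X → Near X (toward B X)
Near-toward zero    zero    = Near-refl 0
Near-toward zero    (suc X) = Near-sym (Near-suc X)
Near-toward (suc B) zero    = Near-suc 0
Near-toward (suc B) (suc X) = let (X≤ , t≤) = Near-toward B X in s≤s X≤ , s≤s t≤

toward-closer : ∀ d B X → B ≤ X + suc d → X ≤ B + suc d → B ≤ toward B X + d × toward B X ≤ B + d
toward-closer d zero    zero    _         _         = z≤n , z≤n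
toward-closer d zero    (suc X) _         (s≤s X≤d) = z≤n , X≤d
toward-closer d (suc B) zero    (s≤s B≤d) _         = s≤s B≤d , s≤s z≤n
toward-closer d (suc B) (suc X) (s≤s B≤)  (s≤s X≤)  = let (B≤′ , t≤′) = toward-closer d B X B≤ X≤ in s≤s B≤′ , s≤s t≤′

toward-arrives : ∀ d B X → B ≤ X + d → X ≤ B + d → iterate (toward B) X d ≡ B
toward-arrives zero    B X B≤X+0 X≤B+0 =
  ≤-antisym (subst (X ≤_) (+-identityʳ B) X≤B+0) (subst (B ≤_) (+-identityʳ X) B≤X+0)
toward-arrives (suc d) B X B≤ X≤ = let (B≤′ , t≤′) = toward-closer d B X B≤ X≤ in toward-arrives d B (toward B X) B≤′ t≤′

walk-arrives : ∀ d B X → B ≤ X + d → X ≤ B + d → fold X (toward B) d ≡ B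
walk-arrives d B X B≤ X≤ = trans (iterate-is-fold X (toward B) d) (toward-arrives d B X B≤ X≤)

module Modular (n' : ℕ) where

  n : ℕ
  n = suc n'

  infix 4 _≈_ _∼_

  -- A record rather than the bare equation, so that X and Y can be inferred from X ≈ Y.
  record _≈_ (X Y : ℕ) : Set where
    constructor mk≈
    field %-≡ : X % n ≡ Y % n
  open _≈_ public

  ≈-refl : X ≈ X
  ≈-refl = mk≈ refl

  ≈-sym : X ≈ Y → Y ≈ X
  ≈-sym (mk≈ e) = mk≈ (sym e)

  ≈-trans : X ≈ Y → Y ≈ Z → X ≈ Z
  ≈-trans (mk≈ e) (mk≈ f) = mk≈ (trans e f)

  ≈-setoid : Setoid 0ℓ 0ℓ
  ≈-setoid = record
    { Carrier = ℕ ; _≈_ = _≈_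
    ; isEquivalence = record { refl = ≈-refl ; sym = ≈-sym ; trans = ≈-trans } }

  _≈?_ : Decidable _≈_
  X ≈? Y = map′ mk≈ %-≡ (X % n ≟ Y % n)

  ≡⇒≈ : X ≡ Y → X ≈ Y
  ≡⇒≈ refl = ≈-refl

  +-congˡ : ∀ c → X ≈ Y → c + X ≈ c + Y
  +-congˡ {X} {Y} c (mk≈ e) = mk≈ (begin
    (c + X) % n            ≡⟨ %-distribˡ-+ c X n ⟩
    (c % n + X % n) % n    ≡⟨ cong (λ r → (c % n + r) % n) e ⟩
    (c % n + Y % n) % n    ≡⟨ %-distribˡ-+ c Y n ⟨
    (c + Y) % n            ∎)
    where open ≡-Reasoning

  suc-cong : X ≈ Y → suc X ≈ suc Y
  suc-cong = +-congˡ 1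

  %-≈ : ∀ X → X % n ≈ X
  %-≈ X = mk≈ (m%n%n≡m%n X n)

  n+-≈ : ∀ X → n + X ≈ X
  n+-≈ X = mk≈ (trans (cong (_% n) (+-comm n X)) ([m+n]%n≡m%n X n))

  suc-cancel : suc X ≈ suc Y → X ≈ Y
  suc-cancel {X} {Y} e = begin
    X            ≈⟨ n+-≈ X ⟨
    n + X        ≡⟨ +-suc n' X ⟨
    n' + suc X   ≈⟨ +-congˡ n' e ⟩
    n' + suc Y   ≡⟨ +-suc n' Y ⟩
    n + Y        ≈⟨ n+-≈ Y ⟩
    Y            ∎
    where open import Relation.Binary.Reasoning.Setoid ≈-setoid

  <n-≈⇒≡ : X < n → Y < n → X ≈ Y → X ≡ Y
  <n-≈⇒≡ X<n Y<n (mk≈ e) = trans (sym (m<n⇒m%n≡m X<n)) (trans e (m<n⇒m%n≡m Y<n))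

  reduced-shift-≉ : ∀ {d r} → 0 < d → d < n → r < n → d + r ≈ r → ⊥
  reduced-shift-≉ {d} {r} 0<d d<n r<n d+r≈r with ≤-<-connex n (d + r)
  ... | inj₂ d+r<n = <⇒≢ 0<d (sym (+-cancelʳ-≡ r d 0 (<n-≈⇒≡ d+r<n r<n d+r≈r)))
  ... | inj₁ n≤d+r = <⇒≢ d<n (+-cancelʳ-≡ r d n (begin
    d + r          ≡⟨ m∸n+n≡m n≤d+r ⟨
    d + r ∸ n + n  ≡⟨ cong (_+ n) (<n-≈⇒≡ s<n r<n (≈-trans (mk≈ (m≤n⇒[n∸m]%m≡n%m n≤d+r)) d+r≈r)) ⟩
    r + n          ≡⟨ +-comm r n ⟩
    n + r          ∎))
    where
      open ≡-Reasoning
      s<n : d + r ∸ n < n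
      s<n = +-cancelʳ-< n _ n (subst (_< n + n) (sym (m∸n+n≡m n≤d+r)) (+-mono-< d<n r<n))

  shift-≉ : ∀ {d} X → 0 < d → d < n → d + X ≈ X → ⊥
  shift-≉ {d} X 0<d d<n d+X≈X = reduced-shift-≉ 0<d d<n (m%n<n X n)
    (≈-trans (+-congˡ d (%-≈ X)) (≈-trans d+X≈X (≈-sym (%-≈ X))))

  ≈-close⇒≡ : X ≤ Y → Y < n + X → X ≈ Y → X ≡ Y
  ≈-close⇒≡ {X} {Y} X≤Y Y<n+X X≈Y with Y ∸ X | m∸n+n≡m X≤Y
  ... | zero  | X≡Y   = X≡Y
  ... | suc d | d+X≡Y = ⊥-elim (shift-≉ X z<s
        (+-cancelʳ-< X (suc d) n (subst (_< n + X) (sym d+X≡Y) Y<n+X))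
        (subst (_≈ X) (sym d+X≡Y) (≈-sym X≈Y)))

  ≈-window : X ≤ Y → Y ≤ n + X → X ≈ Y → Y ≡ X ⊎ Y ≡ n + X
  ≈-window X≤Y Y≤n+X X≈Y with m≤n⇒m<n∨m≡n Y≤n+X
  ... | inj₁ Y<n+X = inj₁ (sym (≈-close⇒≡ X≤Y Y<n+X X≈Y))
  ... | inj₂ Y≡n+X = inj₂ Y≡n+X

  winding : Steps S n → S n ≈ S 0 →
            S n ≡ S 0 ⊎ (∀ j → j < n → S (suc j) ≡ suc (S j)) ⊎ (∀ j → j < n → suc (S (suc j)) ≡ S j)
  winding {S} steps Sn≈S0 with ≤-total (S 0) (S n)
  ... | inj₁ S0≤Sn with ≈-window S0≤Sn (proj₁ (drift n steps)) (≈-sym Sn≈S0)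
  ...   | inj₁ Sn≡S0   = inj₁ Sn≡S0
  ...   | inj₂ Sn≡n+S0 = inj₂ (inj₁ (climbing steps Sn≡n+S0))
  winding {S} steps Sn≈S0 | inj₂ Sn≤S0 with ≈-window Sn≤S0 (proj₂ (drift n steps)) Sn≈S0
  ...   | inj₁ S0≡Sn   = inj₁ (sym S0≡Sn)
  ...   | inj₂ S0≡n+Sn = inj₂ (inj₂ (descending steps S0≡n+Sn))

  _∼_ : ℕ → ℕ → Set
  X ∼ Y = X ≈ Y ⊎ Y ≈ suc X ⊎ X ≈ suc Y

  ∼-sym : X ∼ Y → Y ∼ X
  ∼-sym (inj₁ e)        = inj₁ (≈-sym e)
  ∼-sym (inj₂ (inj₁ e)) = inj₂ (inj₂ e)
  ∼-sym (inj₂ (inj₂ e)) = inj₂ (inj₁ e)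

  ∼-resp-≈ : ∀ {X′ Y′} → X ≈ X′ → Y ≈ Y′ → X ∼ Y → X′ ∼ Y′
  ∼-resp-≈ X≈ Y≈ (inj₁ e)        = inj₁ (≈-trans (≈-sym X≈) (≈-trans e Y≈))
  ∼-resp-≈ X≈ Y≈ (inj₂ (inj₁ e)) = inj₂ (inj₁ (≈-trans (≈-sym Y≈) (≈-trans e (suc-cong X≈))))
  ∼-resp-≈ X≈ Y≈ (inj₂ (inj₂ e)) = inj₂ (inj₂ (≈-trans (≈-sym X≈) (≈-trans e (suc-cong Y≈))))

  Near⇒∼ : Near X Y → X ∼ Y
  Near⇒∼ {X} {Y} (X≤1+Y , Y≤1+X) with <-cmp X Y
  ... | tri≈ _ X≡Y _ = inj₁ (≡⇒≈ X≡Y)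
  ... | tri< X<Y _ _ = inj₂ (inj₁ (≡⇒≈ (≤-antisym Y≤1+X X<Y)))
  ... | tri> _ _ Y<X = inj₂ (inj₂ (≡⇒≈ (≤-antisym X≤1+Y Y<X)))

  closestRep : ℕ → ℕ → ℕ
  closestRep X B with X ≈? B
  ... | yes _ = X
  ... | no _ with suc X ≈? B
  ...   | yes _ = suc X
  ...   | no _  = pred X

  closestRep-spec : ∀ {B} → 0 < X → X ∼ B → closestRep X B ≈ B × Near X (closestRep X B)
  closestRep-spec {X} {B} 0<X X∼B with X ≈? B
  ... | yes X≈B = X≈B , Near-refl X
  ... | no X≉B with suc X ≈? B
  ...   | yes 1+X≈B = 1+X≈B , Near-suc X
  closestRep-spec {suc X} 0<X (inj₁ X≈B)        | no X≉B | no _     = ⊥-elim (X≉B X≈B)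
  closestRep-spec {suc X} 0<X (inj₂ (inj₁ B≈))   | no _   | no 2+X≉B = ⊥-elim (2+X≉B (≈-sym B≈))
  closestRep-spec {suc X} 0<X (inj₂ (inj₂ 1+X≈)) | no _   | no _     = suc-cancel 1+X≈ , Near-sym (Near-suc X)

module Cycle (n' : ℕ) (4≤n : 4 ≤ suc n') where

  open Modular n' public

  private variable
    W : ℕ
    k : ℕ

  3<n : 3 < n
  3<n = 4≤n

  ≈-within-3⇒≡ : X ≈ Y → X ≤ 3 + Y → Y ≤ 3 + X → X ≡ Y
  ≈-within-3⇒≡ {X} {Y} X≈Y X≤3+Y Y≤3+X with ≤-total X Y
  ... | inj₁ X≤Y = ≈-close⇒≡ X≤Y (≤-<-trans Y≤3+X (+-monoˡ-< X 3<n)) X≈Y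
  ... | inj₂ Y≤X = sym (≈-close⇒≡ Y≤X (≤-<-trans X≤3+Y (+-monoˡ-< Y 3<n)) (≈-sym X≈Y))

  ∼-within-2⇒Near : X ∼ Y → X ≤ 2 + Y → Y ≤ 2 + X → Near X Y
  ∼-within-2⇒Near {X} {Y} (inj₁ X≈Y) X≤ Y≤ with ≈-within-3⇒≡ X≈Y (m≤n⇒m≤1+n X≤) (m≤n⇒m≤1+n Y≤)
  ... | refl = Near-refl X
  ∼-within-2⇒Near {X} {Y} (inj₂ (inj₁ Y≈1+X)) X≤ Y≤ with ≈-within-3⇒≡ Y≈1+X (m≤n⇒m≤1+n (m≤n⇒m≤1+n Y≤)) (s≤s X≤)
  ... | refl = Near-suc X
  ∼-within-2⇒Near {X} {Y} (inj₂ (inj₂ X≈1+Y)) X≤ Y≤ with ≈-within-3⇒≡ X≈1+Y (m≤n⇒m≤1+n (m≤n⇒m≤1+n X≤)) (s≤s Y≤)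
  ... | refl = Near-sym (Near-suc Y)

  Near-Near-∼⇒Near : ∀ {Z} → Near X Y → Near Y Z → X ∼ Z → Near X Z
  Near-Near-∼⇒Near X~Y Y~Z X∼Z = let (X≤ , Z≤) = Near-trans-≤2 X~Y Y~Z in ∼-within-2⇒Near X∼Z X≤ Z≤

  2-apart-≁ : Y ≈ 2 + X → X ∼ Y → ⊥
  2-apart-≁ {Y} {X} Y≈2+X (inj₁ X≈Y) =
    shift-≉ X z<s (≤-trans (s≤s (s≤s (s≤s z≤n))) 3<n) (≈-trans (≈-sym Y≈2+X) (≈-sym X≈Y))
  2-apart-≁ {Y} {X} Y≈2+X (inj₂ (inj₁ Y≈1+X)) =
    shift-≉ X z<s (≤-trans (s≤s (s≤s z≤n)) 3<n) (suc-cancel (≈-trans (≈-sym Y≈2+X) Y≈1+X))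
  2-apart-≁ {Y} {X} Y≈2+X (inj₂ (inj₂ X≈1+Y)) =
    shift-≉ X z<s 3<n (≈-sym (≈-trans X≈1+Y (suc-cong Y≈2+X)))

  squeeze : ∀ {P₋ P P₊} → W ∼ P₋ → W ∼ P → W ∼ P₊ → suc P₋ ≈ P → P₊ ≈ suc P → W ≈ P
  squeeze W∼P₋ (inj₁ W≈P) W∼P₊ _ _ = W≈P
  squeeze W∼P₋ (inj₂ (inj₁ P≈1+W)) W∼P₊ _ P₊≈1+P = ⊥-elim (2-apart-≁ (≈-trans P₊≈1+P (suc-cong P≈1+W)) W∼P₊)
  squeeze W∼P₋ (inj₂ (inj₂ W≈1+P)) W∼P₊ 1+P₋≈P _ = ⊥-elim (2-apart-≁ (≈-trans W≈1+P (suc-cong (≈-sym 1+P₋≈P))) (∼-sym W∼P₋))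

  V : Set
  V = Fin n

  Adj : V → V → Set
  Adj = CycleArc n'

  private variable
    a b w : V

  ι : ℕ → V
  ι X = fromℕ< (m%n<n X n)

  toℕ-ι : ∀ X → toℕ (ι X) ≡ X % n
  toℕ-ι X = toℕ-fromℕ< (m%n<n X n)

  ι-≈ : ∀ X → toℕ (ι X) ≈ X
  ι-≈ X = ≈-trans (≡⇒≈ (toℕ-ι X)) (%-≈ X)

  ≈⇒≡ : toℕ a ≈ toℕ b → a ≡ b
  ≈⇒≡ {a} {b} e = toℕ-injective (<n-≈⇒≡ (toℕ<n a) (toℕ<n b) e)

  ι-toℕ : ∀ a → ι (toℕ a) ≡ a
  ι-toℕ a = ≈⇒≡ (ι-≈ (toℕ a))

  ι-cong : X ≈ Y → ι X ≡ ι Y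
  ι-cong {X} {Y} X≈Y = ≈⇒≡ (≈-trans (ι-≈ X) (≈-trans X≈Y (≈-sym (ι-≈ Y))))

  Adj⇒∼ : Adj a b → toℕ a ∼ toℕ b
  Adj⇒∼ (inj₁ e)        = inj₁ (≡⇒≈ e)
  Adj⇒∼ (inj₂ (inj₁ e)) = inj₂ (inj₁ (≈-trans (≡⇒≈ e) (≈-trans (%-≈ _) (≡⇒≈ (+-comm _ 1)))))
  Adj⇒∼ (inj₂ (inj₂ e)) = inj₂ (inj₂ (≈-trans (≡⇒≈ e) (≈-trans (%-≈ _) (≡⇒≈ (+-comm _ 1)))))

  ∼⇒Adj : toℕ a ∼ toℕ b → Adj a b
  ∼⇒Adj (inj₁ e)                = inj₁ (cong toℕ (≈⇒≡ e))
  ∼⇒Adj {a} {b} (inj₂ (inj₁ e)) = inj₂ (inj₁ (reduce (≈-trans e (≡⇒≈ (+-comm 1 (toℕ a))))))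
    where
      reduce : toℕ b ≈ toℕ a + 1 → toℕ b ≡ (toℕ a + 1) % n
      reduce (mk≈ e) = trans (sym (m<n⇒m%n≡m (toℕ<n b))) e
  ∼⇒Adj {a} {b} (inj₂ (inj₂ e)) = inj₂ (inj₂ (reduce (≈-trans e (≡⇒≈ (+-comm 1 (toℕ b))))))
    where
      reduce : toℕ a ≈ toℕ b + 1 → toℕ a ≡ (toℕ b + 1) % n
      reduce (mk≈ e) = trans (sym (m<n⇒m%n≡m (toℕ<n a))) e

  ι-adj : X ∼ Y → Adj (ι X) (ι Y)
  ι-adj {X} {Y} X∼Y = ∼⇒Adj (∼-resp-≈ (≈-sym (ι-≈ X)) (≈-sym (ι-≈ Y)) X∼Y)

  Adj-refl : ∀ a → Adj a a
  Adj-refl a = inj₁ refl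

  Adj-sym : Adj a b → Adj b a
  Adj-sym (inj₁ e)        = inj₁ (sym e)
  Adj-sym (inj₂ (inj₁ e)) = inj₂ (inj₂ e)
  Adj-sym (inj₂ (inj₂ e)) = inj₂ (inj₁ e)

  next prev : V → V
  next a = ι (suc (toℕ a))
  prev a = ι (n' + toℕ a)

  next-≈ : ∀ a → toℕ (next a) ≈ suc (toℕ a)
  next-≈ a = ι-≈ _

  prev-≈ : ∀ a → suc (toℕ (prev a)) ≈ toℕ a
  prev-≈ a = ≈-trans (suc-cong (ι-≈ _)) (n+-≈ (toℕ a))

  ≈suc⇒next : toℕ b ≈ suc (toℕ a) → b ≡ next a
  ≈suc⇒next {b} {a} e = ≈⇒≡ (≈-trans e (≈-sym (next-≈ a)))

  suc≈⇒prev : suc (toℕ b) ≈ toℕ a → b ≡ prev a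
  suc≈⇒prev {b} {a} e = ≈⇒≡ (suc-cancel (≈-trans e (≈-sym (prev-≈ a))))

  next-prev : ∀ a → next (prev a) ≡ a
  next-prev a = sym (≈suc⇒next (≈-sym (prev-≈ a)))

  prev-next : ∀ a → prev (next a) ≡ a
  prev-next a = sym (suc≈⇒prev (≈-sym (next-≈ a)))

  Adj-next : ∀ a → Adj a (next a)
  Adj-next a = ∼⇒Adj (inj₂ (inj₁ (next-≈ a)))

  Adj-prev : ∀ a → Adj a (prev a)
  Adj-prev a = ∼⇒Adj (inj₂ (inj₂ (≈-sym (prev-≈ a))))

  Adj⇒neighbour : Adj a b → b ≡ a ⊎ b ≡ next a ⊎ b ≡ prev a
  Adj⇒neighbour ab with Adj⇒∼ ab
  ... | inj₁ e        = inj₁ (sym (≈⇒≡ e))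
  ... | inj₂ (inj₁ e) = inj₂ (inj₁ (≈suc⇒next e))
  ... | inj₂ (inj₂ e) = inj₂ (inj₂ (suc≈⇒prev (≈-sym e)))

  squeeze-vertex : Adj w (prev b) → Adj w b → Adj w (next b) → w ≡ b
  squeeze-vertex {w} {b} w-prev w-b w-next =
    ≈⇒≡ (squeeze (Adj⇒∼ w-prev) (Adj⇒∼ w-b) (Adj⇒∼ w-next) (prev-≈ b) (next-≈ b))

  Rigid : (V → V) → Set
  Rigid g = (∀ a → g (next a) ≡ next (g a)) ⊎ (∀ a → g (next a) ≡ prev (g a))

  rigid-neighbours : ∀ {g} → Rigid g → ∀ a →
    (g (next a) ≡ next (g a) × g (prev a) ≡ prev (g a)) ⊎
    (g (next a) ≡ prev (g a) × g (prev a) ≡ next (g a))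
  rigid-neighbours {g} (inj₁ g-next) a = inj₁ (g-next a , (begin
    g (prev a)                ≡⟨ prev-next (g (prev a)) ⟨
    prev (next (g (prev a)))  ≡⟨ cong prev (g-next (prev a)) ⟨
    prev (g (next (prev a)))  ≡⟨ cong (λ c → prev (g c)) (next-prev a) ⟩
    prev (g a)                ∎))
    where open ≡-Reasoning
  rigid-neighbours {g} (inj₂ g-next) a = inj₂ (g-next a , (begin
    g (prev a)                ≡⟨ next-prev (g (prev a)) ⟨
    next (prev (g (prev a)))  ≡⟨ cong next (g-next (prev a)) ⟨
    next (g (next (prev a)))  ≡⟨ cong (λ c → next (g c)) (next-prev a) ⟩
    next (g a)                ∎))
    where open ≡-Reasoning

  rigid⇒hom : ∀ {g} → Rigid g → ∀ a b → Adj a b → Adj (g a) (g b)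
  rigid⇒hom {g} rigid a b ab with Adj⇒neighbour ab | rigid-neighbours rigid a
  ... | inj₁ refl        | _             = Adj-refl (g a)
  ... | inj₂ (inj₁ refl) | inj₁ (e , _)  = subst (Adj (g a)) (sym e) (Adj-next (g a))
  ... | inj₂ (inj₁ refl) | inj₂ (e , _)  = subst (Adj (g a)) (sym e) (Adj-prev (g a))
  ... | inj₂ (inj₂ refl) | inj₁ (_ , e)  = subst (Adj (g a)) (sym e) (Adj-prev (g a))
  ... | inj₂ (inj₂ refl) | inj₂ (_ , e)  = subst (Adj (g a)) (sym e) (Adj-next (g a))

  -- The images under g of a and of its two neighbours are three consecutive vertices.
  pinned : ∀ {g} → Rigid g → (∀ s → (∀ c → Adj c (s c)) → Adj w (g (s a))) → w ≡ g a
  pinned {w} {a} {g} rigid near with rigid-neighbours rigid a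
  ... | inj₁ (g-next , g-prev) =
    squeeze-vertex (subst (Adj w) g-prev (near prev Adj-prev)) (near id Adj-refl) (subst (Adj w) g-next (near next Adj-next))
  ... | inj₂ (g-next , g-prev) =
    squeeze-vertex (subst (Adj w) g-next (near next Adj-next)) (near id Adj-refl) (subst (Adj w) g-prev (near prev Adj-prev))

  ι-zero : ι 0 ≡ Fin.zero
  ι-zero = ≈⇒≡ (ι-≈ 0)

  ι-adj-suc : ∀ j → Adj (ι j) (ι (suc j))
  ι-adj-suc j = ι-adj (Near⇒∼ (Near-suc j))

  cycle-induction : (P : V → Set) → P Fin.zero → (∀ {a b} → Adj a b → P a → P b) → ∀ a → P a
  cycle-induction P P0 step a = subst P (ι-toℕ a) (along (toℕ a))
    where
      along : ∀ j → P (ι j)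
      along zero    = subst P (sym ι-zero) P0
      along (suc j) = step (ι-adj-suc j) (along j)

  infix 4 _⇉_
  _⇉_ : Vec V k → Vec V k → Set
  _⇉_ = Pointwise Adj

  ⇉-refl : ∀ (u : Vec V k) → u ⇉ u
  ⇉-refl u = Pointwise.refl (Adj-refl _)

  ⇉-sym : ∀ {u w : Vec V k} → u ⇉ w → w ⇉ u
  ⇉-sym = Pointwise.sym Adj-sym

  updateAt-⇉ : ∀ {s} → (∀ c → Adj c (s c)) → ∀ (u : Vec V k) i → u ⇉ updateAt u i s
  updateAt-⇉ adj-s (c ∷ u) Fin.zero    = adj-s c ∷ ⇉-refl u
  updateAt-⇉ adj-s (c ∷ u) (Fin.suc i) = Adj-refl c ∷ updateAt-⇉ adj-s u i

  tuple-induction : ∀ k (P : Vec V k → Set) → P (replicate k Fin.zero) →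
                    (∀ {u w} → u ⇉ w → P u → P w) → ∀ u → P u
  tuple-induction zero    P P0 step [] = P0
  tuple-induction (suc k) P P0 step (t ∷ x) =
    cycle-induction (λ t → P (t ∷ x))
      (tuple-induction k (λ x → P (Fin.zero ∷ x)) P0 (λ x⇉y → step (Adj-refl Fin.zero ∷ x⇉y)) x)
      (λ ab → step (ab ∷ ⇉-refl x)) t

  Polymorphism : (Vec V k → V) → Set
  Polymorphism φ = ∀ {u w} → u ⇉ w → Adj (φ u) (φ w)

  Unary : (Vec V k → V) → Set
  Unary {k} φ = Σ (Fin k) λ i → Σ (V → V) λ g → Rigid g × (∀ v → φ v ≡ g (lookup v i))

  Lift : {I : Set} → (I → I → Set) → (I → V) → Set
  Lift {I} _R_ φ = Σ (I → ℕ) λ F → (∀ v → F v ≈ toℕ (φ v)) × (∀ {u w} → u R w → Near (F u) (F w))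

  unary-along-head : ∀ {φ : Vec V (suc k) → V} {g i} → Polymorphism φ → Rigid g →
    (∀ x → φ (Fin.zero ∷ x) ≡ g (lookup x i)) → ∀ t x → φ (t ∷ x) ≡ g (lookup x i)
  unary-along-head {φ = φ} {g} {i} φ-poly rigid base =
    cycle-induction (λ t → ∀ x → φ (t ∷ x) ≡ g (lookup x i)) base step
    where
      step : ∀ {a b} → Adj a b → (∀ x → φ (a ∷ x) ≡ g (lookup x i)) → ∀ x → φ (b ∷ x) ≡ g (lookup x i)
      step {a} {b} ab at-a x = pinned rigid λ s adj-s →
        subst (Adj (φ (b ∷ x))) (trans (at-a (updateAt x i s)) (cong g (lookup∘updateAt i x)))
          (φ-poly (Adj-sym ab ∷ updateAt-⇉ adj-s x i))

  unary-along-tail : ∀ {φ : Vec V (suc k) → V} {g} → Polymorphism φ → Rigid g →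
    (∀ t → φ (t ∷ replicate k Fin.zero) ≡ g t) → ∀ x t → φ (t ∷ x) ≡ g t
  unary-along-tail {k} {φ = φ} {g} φ-poly rigid base =
    tuple-induction k (λ x → ∀ t → φ (t ∷ x) ≡ g t) base step
    where
      step : ∀ {u w} → u ⇉ w → (∀ t → φ (t ∷ u) ≡ g t) → ∀ t → φ (t ∷ w) ≡ g t
      step {u} {w} u⇉w at-u t = pinned rigid λ s adj-s →
        subst (Adj (φ (t ∷ w))) (at-u (s t)) (φ-poly (adj-s t ∷ ⇉-sym u⇉w))

  module Unwinding {k} (φ : Vec V (suc k) → V) (φ-poly : Polymorphism φ)
                   (lift₀ : Lift _⇉_ (λ x → φ (Fin.zero ∷ x))) where

    G : Vec V k → ℕ
    G = proj₁ lift₀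

    G-≈ : ∀ x → G x ≈ toℕ (φ (Fin.zero ∷ x))
    G-≈ = proj₁ (proj₂ lift₀)

    G-near : ∀ {x y} → x ⇉ y → Near (G x) (G y)
    G-near = proj₂ (proj₂ lift₀)

    -- L x lifts the closed walk j ↦ φ (ι j ∷ x), 0 ≤ j ≤ n; starting at n + G x keeps it positive.
    L : Vec V k → ℕ → ℕ
    L x zero    = n + G x
    L x (suc j) = closestRep (L x j) (toℕ (φ (ι (suc j) ∷ x)))

    L-step : ∀ x j → j < n → L x j ≈ toℕ (φ (ι j ∷ x)) → n + G x ≤ j + L x j →
             L x (suc j) ≈ toℕ (φ (ι (suc j) ∷ x)) × Near (L x j) (L x (suc j))
    L-step x j j<n L≈ bound = closestRep-spec (positive j<n bound)
      (∼-resp-≈ (≈-sym L≈) ≈-refl (Adj⇒∼ (φ-poly (ι-adj-suc j ∷ ⇉-refl x))))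

    L-spec : ∀ x j → j ≤ n → L x j ≈ toℕ (φ (ι j ∷ x)) × n + G x ≤ j + L x j
    L-spec x zero _ =
      ≈-trans (n+-≈ (G x)) (≈-trans (G-≈ x) (≡⇒≈ (cong (λ a → toℕ (φ (a ∷ x))) (sym ι-zero)))) , ≤-refl
    L-spec x (suc j) j<n with L-spec x j (<⇒≤ j<n)
    ... | L≈ , bound with L-step x j j<n L≈ bound
    ...   | L′≈ , (L≤ , _) = L′≈ , ≤-trans bound (≤-trans (+-monoʳ-≤ j L≤) (≤-reflexive (+-suc j _)))

    L-≈ : ∀ x j → j ≤ n → L x j ≈ toℕ (φ (ι j ∷ x))
    L-≈ x j j≤n = proj₁ (L-spec x j j≤n)

    L-steps : ∀ x → Steps (L x) n
    L-steps x j j<n = let (L≈ , bound) = L-spec x j (<⇒≤ j<n) in proj₂ (L-step x j j<n L≈ bound)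

    L-∼ : ∀ {x y i j} → x ⇉ y → Adj (ι i) (ι j) → i ≤ n → j ≤ n → L x i ∼ L y j
    L-∼ x⇉y ij i≤n j≤n = ∼-resp-≈ (≈-sym (L-≈ _ _ i≤n)) (≈-sym (L-≈ _ _ j≤n)) (Adj⇒∼ (φ-poly (ij ∷ x⇉y)))

    L-near-column   : ∀ {x y} → x ⇉ y → ∀ j → j ≤ n → Near (L x j) (L y j)
    L-near-diagonal : ∀ {x y} → x ⇉ y → ∀ j → j < n → Near (L x (suc j)) (L y j)
    L-near-column x⇉y zero _ = Near-+ˡ n (G-near x⇉y)
    L-near-column {y = y} x⇉y (suc j) j<n =
      Near-Near-∼⇒Near (L-near-diagonal x⇉y j j<n) (L-steps y j j<n) (L-∼ x⇉y (Adj-refl _) j<n j<n)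
    L-near-diagonal {x} x⇉y j j<n =
      Near-Near-∼⇒Near (Near-sym (L-steps x j j<n)) (L-near-column x⇉y j (<⇒≤ j<n))
        (L-∼ x⇉y (Adj-sym (ι-adj-suc j)) j<n (<⇒≤ j<n))

    Unwound : Vec V k → Set
    Unwound x = L x n ≡ L x 0

    L-closed : ∀ x → L x n ≈ L x 0
    L-closed x = ≈-trans (L-≈ x n ≤-refl)
      (≈-trans (≡⇒≈ (cong (λ a → toℕ (φ (a ∷ x))) ι-n≡ι-0)) (≈-sym (L-≈ x 0 z≤n)))
      where
        ι-n≡ι-0 : ι n ≡ ι 0
        ι-n≡ι-0 = ι-cong (≈-trans (≡⇒≈ (sym (+-identityʳ n))) (n+-≈ 0))

    unwound-⇉ : ∀ {x y} → x ⇉ y → Unwound x → Unwound y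
    unwound-⇉ {x} {y} x⇉y x-unwound =
      let (Lyn≤ , Ly0≤) = Near-trans-≤2 (Near-sym (L-near-column x⇉y n ≤-refl))
                            (subst (λ X → Near X (L y 0)) (sym x-unwound) (L-near-column x⇉y 0 z≤n))
      in ≈-within-3⇒≡ (L-closed y) (m≤n⇒m≤1+n Lyn≤) (m≤n⇒m≤1+n Ly0≤)

    L-next : ∀ {x} → Unwound x → ∀ a → L x (toℕ (next a)) ≡ L x (suc (toℕ a))
    L-next {x} x-unwound a with m≤n⇒m<n∨m≡n (toℕ<n a)
    ... | inj₁ 1+a<n = cong (L x) (trans (toℕ-ι (suc (toℕ a))) (m<n⇒m%n≡m 1+a<n))
    ... | inj₂ 1+a≡n = begin
      L x (toℕ (next a))   ≡⟨ cong (L x) (trans (toℕ-ι (suc (toℕ a))) (trans (cong (_% n) 1+a≡n) (n%n≡0 n))) ⟩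
      L x 0                ≡⟨ x-unwound ⟨
      L x n                ≡⟨ cong (L x) 1+a≡n ⟨
      L x (suc (toℕ a))    ∎
      where open ≡-Reasoning

    lift : (∀ x → Unwound x) → Lift _⇉_ φ
    lift unwound = F , F-≈ , F-near
      where
        F : Vec V (suc k) → ℕ
        F (t ∷ x) = L x (toℕ t)

        F-≈ : ∀ v → F v ≈ toℕ (φ v)
        F-≈ (t ∷ x) = subst (λ a → L x (toℕ t) ≈ toℕ (φ (a ∷ x))) (ι-toℕ t) (L-≈ x (toℕ t) (<⇒≤ (toℕ<n t)))

        near-next : ∀ {x y} → x ⇉ y → ∀ t → Near (L x (toℕ (next t))) (L y (toℕ t))
        near-next {x} {y} x⇉y t = subst (λ X → Near X (L y (toℕ t))) (sym (L-next (unwound x) t))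
                                   (L-near-diagonal x⇉y (toℕ t) (toℕ<n t))

        F-near : ∀ {u w} → u ⇉ w → Near (F u) (F w)
        F-near {t ∷ x} {s ∷ y} (ts ∷ x⇉y) with Adj⇒neighbour ts
        ... | inj₁ refl        = L-near-column x⇉y (toℕ t) (<⇒≤ (toℕ<n t))
        ... | inj₂ (inj₁ refl) = Near-sym (near-next (⇉-sym x⇉y) t)
        ... | inj₂ (inj₂ refl) = subst (λ a → Near (L x (toℕ a)) (L y (toℕ (prev t)))) (next-prev t)
                                   (near-next x⇉y (prev t))

    origin : Vec V k
    origin = replicate k Fin.zero

    slice : V → V
    slice t = φ (t ∷ origin)

    slice-≈ : ∀ a → L origin (toℕ a) ≈ toℕ (slice a)
    slice-≈ a = subst (λ c → L origin (toℕ a) ≈ toℕ (slice c)) (ι-toℕ a) (L-≈ origin (toℕ a) (<⇒≤ (toℕ<n a)))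

    slice-next-≈ : ∀ a → L origin (suc (toℕ a)) ≈ toℕ (slice (next a))
    slice-next-≈ a = L-≈ origin (suc (toℕ a)) (toℕ<n a)

    slice-unary : Rigid slice → Unary φ
    slice-unary rigid =
      Fin.zero , slice , rigid , λ { (t ∷ x) → unary-along-tail φ-poly rigid (λ _ → refl) x t }

    climbing⇒rigid : (∀ j → j < n → L origin (suc j) ≡ suc (L origin j)) → Rigid slice
    climbing⇒rigid climbs = inj₁ λ a → ≈suc⇒next (begin
      toℕ (slice (next a))     ≈⟨ slice-next-≈ a ⟨
      L origin (suc (toℕ a))   ≡⟨ climbs (toℕ a) (toℕ<n a) ⟩
      suc (L origin (toℕ a))   ≈⟨ suc-cong (slice-≈ a) ⟩
      suc (toℕ (slice a))      ∎)
      where open import Relation.Binary.Reasoning.Setoid ≈-setoid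

    descending⇒rigid : (∀ j → j < n → suc (L origin (suc j)) ≡ L origin j) → Rigid slice
    descending⇒rigid descends = inj₂ λ a → suc≈⇒prev (begin
      suc (toℕ (slice (next a)))    ≈⟨ suc-cong (slice-next-≈ a) ⟨
      suc (L origin (suc (toℕ a)))  ≡⟨ descends (toℕ a) (toℕ<n a) ⟩
      L origin (toℕ a)              ≈⟨ slice-≈ a ⟩
      toℕ (slice a)                 ∎)
      where open import Relation.Binary.Reasoning.Setoid ≈-setoid

    unary-or-extended-lift : Unary φ ⊎ Lift _⇉_ φ
    unary-or-extended-lift with winding (L-steps origin) (L-closed origin)
    ... | inj₁ unwound         = inj₂ (lift (tuple-induction k Unwound unwound unwound-⇉))
    ... | inj₂ (inj₁ climbs)   = inj₁ (slice-unary (climbing⇒rigid climbs))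
    ... | inj₂ (inj₂ descends) = inj₁ (slice-unary (descending⇒rigid descends))

  unary-or-lift : ∀ k (φ : Vec V k → V) → Polymorphism φ → Unary φ ⊎ Lift _⇉_ φ
  unary-or-lift zero φ _ = inj₂ ((λ v → toℕ (φ v)) , (λ _ → ≈-refl) , λ { [] → Near-refl _ })
  unary-or-lift (suc k) φ φ-poly
    with unary-or-lift k (λ x → φ (Fin.zero ∷ x)) (λ x⇉y → φ-poly (Adj-refl Fin.zero ∷ x⇉y))
  ... | inj₁ (i , g , rigid , base) =
    inj₁ (Fin.suc i , g , rigid , λ { (t ∷ x) → unary-along-head φ-poly rigid base t x })
  ... | inj₂ lift₀ = Unwinding.unary-or-extended-lift φ φ-poly lift₀

  infix 4 _⇶_
  _⇶_ : (Fin k → V) → (Fin k → V) → Set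
  x ⇶ y = ∀ i → Adj (x i) (y i)

  tabulate-⇉⇒⇶ : ∀ {z : Fin k → V} {u} → tabulate z ⇉ u → z ⇶ lookup u
  tabulate-⇉⇒⇶ {z = z} h i = subst (λ a → Adj a _) (lookup∘tabulate z i) (Pointwise.lookup h i)

  module OnFunctions {k} (f : (Fin k → V) → V) (f-poly : ∀ x y → x ⇶ y → Adj (f x) (f y)) where

    φ : Vec V k → V
    φ v = f (lookup v)

    φ-poly : Polymorphism φ
    φ-poly u⇉w = f-poly _ _ (Pointwise.lookup u⇉w)

    -- f need not be extensional: f z and φ (tabulate z) are only known to be adjacent.
    f-adj-φ : ∀ {z u} → tabulate z ⇉ u → Adj (f z) (φ u)
    f-adj-φ h = f-poly _ _ (tabulate-⇉⇒⇶ h)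

    unary-transfer : Unary φ → Σ (Fin k) λ i → Σ (V → V) λ g → Rigid g × (∀ z → f z ≡ g (z i))
    unary-transfer (i , g , rigid , φ≡) = i , g , rigid , λ z → pinned rigid λ s adj-s →
      subst (Adj (f z)) (begin
        φ (updateAt (tabulate z) i s)              ≡⟨ φ≡ (updateAt (tabulate z) i s) ⟩
        g (lookup (updateAt (tabulate z) i s) i)   ≡⟨ cong g (lookup∘updateAt i (tabulate z)) ⟩
        g (s (lookup (tabulate z) i))              ≡⟨ cong (λ c → g (s c)) (lookup∘tabulate z i) ⟩
        g (s (z i))                                ∎)
        (f-adj-φ (updateAt-⇉ adj-s (tabulate z) i))
      where open ≡-Reasoning

    lift-transfer : Lift _⇉_ φ → Lift _⇶_ f
    lift-transfer (F , F-≈ , F-near) = F′ , (λ z → proj₁ (F′-spec z)) , F′-near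
      where
        base : (Fin k → V) → ℕ
        base z = n + F (tabulate z)

        f-∼-base : ∀ {z z′} → z ⇶ z′ → toℕ (f z) ∼ base z′
        f-∼-base {z′ = z′} z⇶z′ = ∼-resp-≈ ≈-refl (≈-trans (≈-sym (F-≈ _)) (≈-sym (n+-≈ _)))
          (Adj⇒∼ (f-adj-φ (tabulate⁺ z⇶z′)))

        F′ : (Fin k → V) → ℕ
        F′ z = closestRep (base z) (toℕ (f z))

        F′-spec : ∀ z → F′ z ≈ toℕ (f z) × Near (base z) (F′ z)
        F′-spec z = closestRep-spec z<s (∼-sym (f-∼-base (λ i → Adj-refl (z i))))

        F′-near : ∀ {z z′} → z ⇶ z′ → Near (F′ z) (F′ z′)
        F′-near {z} {z′} z⇶z′ =
          Near-Near-∼⇒Near F′z~base-z′ (proj₂ (F′-spec z′))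
            (∼-resp-≈ (≈-sym (proj₁ (F′-spec z))) (≈-sym (proj₁ (F′-spec z′))) (Adj⇒∼ (f-poly z z′ z⇶z′)))
          where
            F′z~base-z′ : Near (F′ z) (base z′)
            F′z~base-z′ = Near-Near-∼⇒Near (Near-sym (proj₂ (F′-spec z))) (Near-+ˡ n (F-near (tabulate⁺ z⇶z′)))
              (∼-resp-≈ (≈-sym (proj₁ (F′-spec z))) ≈-refl (f-∼-base z⇶z′))

  function-unary-or-lift : ∀ {k} (f : (Fin k → V) → V) → (∀ x y → x ⇶ y → Adj (f x) (f y)) →
    (Σ (Fin k) λ i → Σ (V → V) λ g → Rigid g × (∀ z → f z ≡ g (z i))) ⊎ Lift _⇶_ f
  function-unary-or-lift {k} f f-poly = Sum.map unary-transfer lift-transfer (unary-or-lift k φ φ-poly)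
    where open OnFunctions f f-poly

module EvenCycleSlupecki (p : ℕ) where

  m : ℕ
  m = suc (suc p)

  n' : ℕ
  n' = suc (2 * suc p)

  open Cycle n' (s≤s (s≤s (*-monoʳ-≤ 2 (s≤s (z≤n {p})))))

  m+m≡n : m + m ≡ n
  m+m≡n = cong (λ x → suc (suc x)) (trans (+-suc p (suc p)) (cong (λ x → suc (p + suc x)) (sym (+-identityʳ p))))

  m<n' : m < n'
  m<n' = s≤s (s≤s (≤-trans (s≤s (m≤m+n p (p + 0))) (≤-reflexive (sym (+-suc p (p + 0))))))

  far-representatives : ∀ {A B} → A + m < B → B < n → B ≤ (n + A) + m × n + A ≤ B + m
  far-representatives {A} {B} A+m<B B<n =
    ≤-trans (<⇒≤ B<n) (≤-trans (m≤m+n n A) (m≤m+n (n + A) m)) , (begin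
      n + A         ≡⟨ cong (_+ A) m+m≡n ⟨
      m + m + A     ≡⟨ +-assoc m m A ⟩
      m + (m + A)   ≡⟨ cong (m +_) (+-comm m A) ⟩
      m + (A + m)   ≤⟨ +-monoʳ-≤ m (<⇒≤ A+m<B) ⟩
      m + B         ≡⟨ +-comm m B ⟩
      B + m         ∎)
    where open ≤-Reasoning

  close-representatives : ∀ A B → A < n → B < n →
    Σ ℕ λ A′ → Σ ℕ λ B′ → A′ ≈ A × B′ ≈ B × B′ ≤ A′ + m × A′ ≤ B′ + m
  close-representatives A B A<n B<n with B ≤? A + m | A ≤? B + m
  ... | yes B≤ | yes A≤ = A , B , ≈-refl , ≈-refl , B≤ , A≤
  ... | no B≰  | _      = let (B≤ , A≤) = far-representatives (≰⇒> B≰) B<n in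
                          n + A , B , n+-≈ A , ≈-refl , B≤ , A≤
  ... | yes _  | no A≰  = let (A≤ , B≤) = far-representatives (≰⇒> A≰) A<n in
                          A , n + B , ≈-refl , n+-≈ B , B≤ , A≤

  walk : ∀ a b → Σ (ℕ → V) λ P → P 0 ≡ a × P m ≡ b × (∀ s → Adj (P s) (P (suc s)))
  walk a b with close-representatives (toℕ a) (toℕ b) (toℕ<n a) (toℕ<n b)
  ... | A′ , B′ , A′≈ , B′≈ , B′≤ , A′≤ =
    P , trans (ι-cong A′≈) (ι-toℕ a) ,
    trans (cong ι (walk-arrives m B′ A′ B′≤ A′≤)) (trans (ι-cong B′≈) (ι-toℕ b)) ,
    λ s → ι-adj (Near⇒∼ (Near-toward B′ (fold A′ (toward B′) s)))
    where
      P : ℕ → V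
      P s = ι (fold A′ (toward B′) s)

  spread : ∀ {k} (F : (Fin k → V) → ℕ) → (∀ {z z′} → z ⇶ z′ → Near (F z) (F z′)) → ∀ z z′ → F z ≤ m + F z′
  spread F F-near z z′ = begin
    F z                            ≤⟨ proj₁ (F-near first) ⟩
    suc (F (Q 1))                  ≤⟨ s≤s (proj₂ (drift p middle)) ⟩
    suc (p + F (Q (suc p)))        ≤⟨ s≤s (+-monoʳ-≤ p (proj₁ (F-near last))) ⟩
    suc (p + suc (F z′))           ≡⟨ cong suc (+-suc p (F z′)) ⟩
    m + F z′                       ∎
    where
      open ≤-Reasoning
      Q : ℕ → Fin _ → V
      Q s i = proj₁ (walk (z i) (z′ i)) s
      step : ∀ s i → Adj (Q s i) (Q (suc s) i)
      step s i = proj₂ (proj₂ (proj₂ (walk (z i) (z′ i)))) s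
      first : z ⇶ Q 1
      first i = subst (λ a → Adj a (Q 1 i)) (proj₁ (proj₂ (walk (z i) (z′ i)))) (step 0 i)
      last : Q (suc p) ⇶ z′
      last i = subst (Adj (Q (suc p) i)) (proj₁ (proj₂ (proj₂ (walk (z i) (z′ i))))) (step (suc p) i)
      middle : Steps (λ s → F (Q (suc s))) p
      middle s _ = F-near (step (suc s))

  window-misses : ∀ {Z : Set} (F : Z → ℕ) B → (∀ z → B ≤ F z × F z ≤ m + B) → ∀ z → F z ≈ n' + B → ⊥
  window-misses F B window z Fz≈ =
    <⇒≱ (+-monoˡ-< B m<n') (subst (_≤ m + B) Fz≡n′+B (proj₂ (window z)))
    where
      Fz≡n′+B : F z ≡ n' + B
      Fz≡n′+B = ≈-close⇒≡ (≤-trans (proj₂ (window z)) (+-monoˡ-≤ B (<⇒≤ m<n')))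
        (<-≤-trans (+-monoˡ-< B ≤-refl) (+-monoʳ-≤ n (proj₁ (window z)))) Fz≈

  -- A value congruent to m + F z₀ is F z₀ + m or F z₀ − m, and either way it pins all values
  -- into a window of width m, which misses the residue just below it.
  spread-not-onto : ∀ {Z : Set} (F : Z → ℕ) → (∀ z z′ → F z ≤ m + F z′) → (∀ X → Σ Z λ z → F z ≈ X) → ⊥
  spread-not-onto F spread hit with hit 0
  ... | z₀ , _ with hit (m + F z₀)
  ... | z₁ , Fz₁≈ with ≈-window (spread z₁ z₀) m+Fz₀≤ Fz₁≈
    where
      m+Fz₀≤ : m + F z₀ ≤ n + F z₁
      m+Fz₀≤ = ≤-trans (+-monoʳ-≤ m (spread z₀ z₁)) (≤-reflexive (trans (sym (+-assoc m m _)) (cong (_+ F z₁) m+m≡n)))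
  ... | inj₁ m+Fz₀≡Fz₁ = let (z , Fz≈) = hit (n' + F z₀) in window-misses F (F z₀)
        (λ y → +-cancelˡ-≤ m _ _ (subst (_≤ m + F y) (sym m+Fz₀≡Fz₁) (spread z₁ y)) , spread y z₀) z Fz≈
  ... | inj₂ m+Fz₀≡n+Fz₁ = let (z , Fz≈) = hit (n' + F z₁) in window-misses F (F z₁)
        (λ y → +-cancelˡ-≤ m _ _ (subst (_≤ m + F y) Fz₀≡m+Fz₁ (spread z₀ y)) , spread y z₁) z Fz≈
    where
      Fz₀≡m+Fz₁ : F z₀ ≡ m + F z₁
      Fz₀≡m+Fz₁ = +-cancelˡ-≡ m _ _ (trans m+Fz₀≡n+Fz₁ (trans (cong (_+ F z₁) (sym m+m≡n)) (+-assoc m m _)))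

  slupecki : Slupecki (EvenCycle m)
  slupecki k _ f f-poly onto with function-unary-or-lift f f-poly
  ... | inj₁ (i , g , rigid , f≡) = i , g , rigid⇒hom rigid , f≡
  ... | inj₂ (F , F-≈ , F-near) = ⊥-elim (spread-not-onto F (spread F F-near) hit)
    where
      hit : ∀ X → Σ (Fin _ → V) λ z → F z ≈ X
      hit X = let (z , fz≡ιX) = onto (ι X) in z , ≈-trans (F-≈ z) (≈-trans (≡⇒≈ (cong toℕ fz≡ιX)) (ι-≈ X))

proposition4p6 : ∀ (m : ℕ) → m ≥ 2 → Slupecki (EvenCycle m)
proposition4p6 (suc zero)    (s≤s ())
proposition4p6 (suc (suc p)) _ = EvenCycleSlupecki.slupecki p
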